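{- Let $\Gamma$ be an arbitrary finite graph. Then: (1) the edges of $\Gamma$ can be linearly ordered so that an edge is the maximal edge of some chordless cycle if and only if it is one of the last $|\operatorname{Edg}|-|\operatorname{Ver}|+|\operatorname{Con}|$ edges in the order; (2) $|\operatorname{Cyc}|\ge|\operatorname{Edg}|-|\operatorname{Ver}|+|\operatorname{Con}|$; (3) the sequence $0\to\mathbb{F}_2^{\operatorname{Con}}\to\mathbb{F}_2^{\operatorname{Ver}}\to\mathbb{F}_2^{\operatorname{Edg}}\to\mathbb{F}_2^{\operatorname{Cyc}}$ is exact.
   Context: Graphs are finite, simple, undirected. A chordless cycle in $\Gamma$ is an induced subgraph isomorphic to a cycle of length at least $3$. $\operatorname{Ver},\operatorname{Edg},\operatorname{Con},\operatorname{Cyc}$ denote the sets of vertices, edges, connected components, and chordless cycles of $\Gamma$. For a finite set $X$, $\mathbb{F}_2^X$ is the space of functions $X\to\mathbb{F}_2$. For an incidence relation $I\subset X\times Y$, $\rho_I:\mathbb{F}_2^X\to\mathbb{F}_2^Y$ is $(\rho_If)(y)=\sum_{(x,y)\in I}f(x)$. The maps in the sequence are $\rho_I$ for the natural incidences: a component contains a vertex, a vertex is an endpoint of an edge, an edge lies in a chordless cycle. -}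

module Defs where

open import Data.Bool using (Bool; true; false; _xor_; _∧_; _∨_)
open import Data.Nat as ℕ using (ℕ; zero; suc; _%_)
open import Data.Integer as ℤ using (ℤ; +_; _-_; _+_)
open import Data.Fin as Fin using (Fin; toℕ; _≤_)
open import Data.Fin.Subset using (Subset; _∈_)
open import Data.Fin.Permutation using (Permutation; _⟨$⟩ʳ_)
open import Data.Vec using (lookup)
open import Data.Product using (Σ; ∃; _×_; _,_)
open import Data.Sum using (_⊎_)
open import Function using (_∘_; _⇔_)
open import Function.Definitions using (Injective; Surjective)
open import Relation.Nullary using (¬_)
open import Relation.Nullary.Decidable using (⌊_⌋)
open import Relation.Binary.PropositionalEquality using (_≡_; _≢_)
open import Relation.Binary.Construct.Closure.ReflexiveTransitive using (Star)

-- Finite simple graphs.  Vertices are Fin nV, edges are Fin nE; edge e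
-- is the unordered pair {src e , tgt e}.  No loops, no multiple edges.

SameEnds : ∀ {nV} → Fin nV → Fin nV → Fin nV → Fin nV → Set
SameEnds a b a' b' = (a ≡ a' × b ≡ b') ⊎ (a ≡ b' × b ≡ a')

record Graph : Set where
  field
    nV nE    : ℕ
    src tgt  : Fin nE → Fin nV
    loopless : ∀ e → src e ≢ tgt e
    simple   : ∀ e e' → SameEnds (src e) (tgt e) (src e') (tgt e') → e ≡ e'

module _ (G : Graph) where
  open Graph G

  Adj : Fin nV → Fin nV → Set
  Adj u v = ∃ λ e → SameEnds (src e) (tgt e) u v

  Connected : Fin nV → Fin nV → Set
  Connected = Star Adj

  -- comp : Fin nV → Fin c labels the connected components bijectively by
  -- Fin c (so Con ≅ Fin c): every label is used, and two vertices get the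
  -- same label iff they are connected.
  IsComponentLabelling : ∀ {c} → (Fin nV → Fin c) → Set
  IsComponentLabelling comp =
    Surjective _≡_ _≡_ comp × (∀ u v → (comp u ≡ comp v) ⇔ Connected u v)

  -- adjacency in the cycle graph C_k on Fin k (k ≥ 3 written as 3 + k')
  CycAdj : ∀ k' → Fin (3 ℕ.+ k') → Fin (3 ℕ.+ k') → Set
  CycAdj k' i j = (suc (toℕ i) % (3 ℕ.+ k') ≡ toℕ j)
                ⊎ (suc (toℕ j) % (3 ℕ.+ k') ≡ toℕ i)

  -- The induced subgraph on the vertex set S is isomorphic to a cycle of
  -- length ≥ 3 (a chordless cycle is determined by its vertex set).
  IsChordlessCycle : Subset nV → Set
  IsChordlessCycle S =
    Σ ℕ λ k' → Σ (Fin (3 ℕ.+ k') → Fin nV) λ f →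
      Injective _≡_ _≡_ f
      × (∀ v → v ∈ S ⇔ ∃ λ i → f i ≡ v)
      × (∀ i j → Adj (f i) (f j) ⇔ CycAdj k' i j)

  -- cyc : Fin k → Subset nV enumerates the chordless cycles of G without
  -- repetition (so Cyc ≅ Fin k).
  IsCycleEnumeration : ∀ {k} → (Fin k → Subset nV) → Set
  IsCycleEnumeration cyc =
    Injective _≡_ _≡_ cyc
    × (∀ j → IsChordlessCycle (cyc j))
    × (∀ S → IsChordlessCycle S → ∃ λ j → cyc j ≡ S)

  -- edge e lies in the (induced) chordless cycle with vertex set S
  _EdgeIn_ : Fin nE → Subset nV → Set
  e EdgeIn S = src e ∈ S × tgt e ∈ S

  cyclomatic : ℕ → ℤ
  cyclomatic c = + nE - + nV + + c

  IsMaxEdgeOfChordlessCycle : Permutation nE nE → Fin nE → Set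
  IsMaxEdgeOfChordlessCycle pos e =
    ∃ λ S → IsChordlessCycle S × e EdgeIn S
      × (∀ e' → e' EdgeIn S → (pos ⟨$⟩ʳ e') ≤ (pos ⟨$⟩ʳ e))

-- F₂-linear algebra: F₂ = Bool with xor, F₂^X = functions X → Bool.

∑ : ∀ {a} → (Fin a → Bool) → Bool
∑ {zero}  f = false
∑ {suc a} f = f Fin.zero xor ∑ (f ∘ Fin.suc)

ρ : ∀ {a b} → (Fin a → Fin b → Bool) → (Fin a → Bool) → (Fin b → Bool)
ρ I f y = ∑ (λ x → I x y ∧ f x)

IsZero : ∀ {a} → (Fin a → Bool) → Set
IsZero f = ∀ x → f x ≡ false

_≗_ : ∀ {a} → (Fin a → Bool) → (Fin a → Bool) → Set
f ≗ g = ∀ x → f x ≡ g x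

ExactAt : ∀ {a b c} → ((Fin a → Bool) → (Fin b → Bool))
        → ((Fin b → Bool) → (Fin c → Bool)) → Set
ExactAt φ ψ = ∀ y → IsZero (ψ y) ⇔ (∃ λ x → φ x ≗ y)

ExactAtStart : ∀ {a b} → ((Fin a → Bool) → (Fin b → Bool)) → Set
ExactAtStart φ = ∀ x → IsZero (φ x) ⇔ IsZero x

module _ (G : Graph) where
  open Graph G

  I-CV : ∀ {c} → (Fin nV → Fin c) → Fin c → Fin nV → Bool
  I-CV comp c v = ⌊ comp v Fin.≟ c ⌋

  I-VE : Fin nV → Fin nE → Bool
  I-VE v e = ⌊ src e Fin.≟ v ⌋ ∨ ⌊ tgt e Fin.≟ v ⌋

  I-EC : ∀ {k} → (Fin k → Subset nV) → Fin nE → Fin k → Bool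
  I-EC cyc e j = lookup (cyc j) (src e) ∧ lookup (cyc j) (tgt e)

{-# OPTIONS --safe #-}
module Submission where

-- Order the edges greedily.  While some unplaced edge joins two components of the subgraph of the
-- placed edges, place it next: the indicator y of one of these components has coboundary δ y = 1
-- on it and δ y = 0 on every earlier edge.  Otherwise place the unplaced edge whose ends are joined by the
-- shortest walk through placed edges; that walk closes up into a chordless cycle in which the new
-- edge is maximal.  The first kind are the |Ver| - |Con| edges of a spanning forest.  As δ y sums to
-- zero around every cycle, a forest edge is never the maximum of a chordless cycle, which gives (1),
-- and distinct later edges are the maxima of distinct cycles, which gives (2).  For exactness at
-- F₂^Edg, solve δ y = z one edge at a time in this order: across a forest edge add a multiple of
-- its colouring; a cycle edge needs nothing, since z and δ y both sum to zero around its cycle and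
-- agree on its earlier edges.

open import Defs

module Preliminaries where

  open import Algebra.Bundles using (CommutativeRing)
  open import Data.Bool using (Bool; true; false; _xor_; _∧_)
  open import Data.Bool.Properties
    using (xor-∧-commutativeRing; xor-comm; xor-identityʳ; xor-same; ∧-identityʳ; ∧-distribˡ-xor)
  open import Data.Nat as ℕ using (ℕ; zero; suc; _+_; _∸_; _%_; _<_; _≤_; s≤s; z<s)
  open import Data.Nat.Properties
    using ( anyUpTo?; m≤n⇒m<n∨m≡n; suc-injective; <-irrefl; <⇒≱; <⇒≤; <-≤-trans; +-monoˡ-<
          ; m+[n∸m]≡n; ∸-monoʳ-<; m∸n≤m; m∸[m∸n]≡n)
  open import Data.Nat.DivMod using (m%n<n; m<n⇒m%n≡m; n%n≡0)
  open import Data.Nat.Induction using (<-wellFounded)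
  open import Data.Integer as ℤ using (+_)
  open import Data.Integer.Properties using (pos-+; m-n≡m⊖n; ⊖-≥)
  open import Data.Integer.Tactic.RingSolver using (solve-∀)
  open import Data.Fin using (Fin; zero; suc; toℕ; fromℕ<; fromℕ; inject₁; punchIn; punchOut; _≟_)
  open import Data.Fin.Properties as Finₚ
    using ( punchOut-cong; punchOut-injective; punchOut-punchIn; punchInᵢ≢i; toℕ-fromℕ<; toℕ-injective
          ; toℕ<n; toℕ-fromℕ; toℕ-inject₁; injective⇒≤)
  open import Data.Fin.Permutation using (Permutation; permutation)
  import Data.Fin.Permutation.Components as PC
  open import Data.Fin.Subset using (_∈_)
  open import Data.Vec using (tabulate)
  open import Data.Vec.Properties using (lookup∘tabulate; []=⇒lookup; lookup⇒[]=)
  open import Data.Product using (∃; _×_; _,_; proj₁; proj₂)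
  open import Data.Sum using (_⊎_; inj₁; inj₂)
  open import Data.Empty using (⊥-elim)
  open import Function using (_∘_; _⇔_; mk⇔; Injective; StrictlySurjective; Equivalence)
  open import Induction.WellFounded using (Acc; acc)
  open import Relation.Nullary using (Dec; yes; no; ¬_)
  open import Relation.Nullary.Decidable using (⌊_⌋; isYes≗does; dec-true; dec-false; does-⇔)
  open import Relation.Unary using (Decidable)
  open import Relation.Binary.PropositionalEquality hiding (_≗_)
  open import Relation.Binary.Construct.Closure.ReflexiveTransitive using (Star; ε; _◅_)
  open ≡-Reasoning

  open import Algebra.Properties.Semiring.Sum (CommutativeRing.semiring xor-∧-commutativeRing)
    using (sum; sum-cong-≗; sum-replicate-zero; ∑-distrib-+; ∑-comm; ∑-permute; *-distribʳ-sum)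

  false≢true : false ≢ true
  false≢true ()

  xor≡false⇒≡ : ∀ {a b} → a xor b ≡ false → a ≡ b
  xor≡false⇒≡ {false} refl = refl
  xor≡false⇒≡ {true} {true} _ = refl

  ⌊⌋-⇔ : ∀ {A B : Set} → A ⇔ B → (a? : Dec A) (b? : Dec B) → ⌊ a? ⌋ ≡ ⌊ b? ⌋
  ⌊⌋-⇔ A⇔B a? b? = trans (isYes≗does a?) (trans (does-⇔ A⇔B a? b?) (sym (isYes≗does b?)))

  ⌊⌋-true : ∀ {A : Set} (a? : Dec A) → A → ⌊ a? ⌋ ≡ true
  ⌊⌋-true a? a = trans (isYes≗does a?) (dec-true a? a)

  ⌊⌋-false : ∀ {A : Set} (a? : Dec A) → ¬ A → ⌊ a? ⌋ ≡ false
  ⌊⌋-false a? ¬a = trans (isYes≗does a?) (dec-false a? ¬a)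

  ∑≡sum : ∀ {n} (f : Fin n → Bool) → ∑ f ≡ sum f
  ∑≡sum {zero}  f = refl
  ∑≡sum {suc n} f = cong (f zero xor_) (∑≡sum (f ∘ suc))

  sum-indicator : ∀ {n} (s : Fin n) (g : Fin n → Bool) → sum (λ x → ⌊ s ≟ x ⌋ ∧ g x) ≡ g s
  sum-indicator {suc n} zero    g = trans (cong (g zero xor_) (sum-replicate-zero n)) (xor-identityʳ (g zero))
  sum-indicator {suc n} (suc s) g = begin
    sum (λ x → ⌊ suc s ≟ suc x ⌋ ∧ g (suc x))  ≡⟨ sum-cong-≗ (λ x → cong (_∧ g (suc x)) (shift x)) ⟩
    sum (λ x → ⌊ s ≟ x ⌋ ∧ g (suc x))          ≡⟨ sum-indicator s (g ∘ suc) ⟩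
    g (suc s)                                  ∎
    where
    shift : ∀ x → ⌊ suc s ≟ suc x ⌋ ≡ ⌊ s ≟ x ⌋
    shift x = ⌊⌋-⇔ (mk⇔ Finₚ.suc-injective (cong suc)) (suc s ≟ suc x) (s ≟ x)

  -- b x is the sum over t of [h t ≡ x]; exchanging the two sums leaves the sum of g (h t).
  sum-image : ∀ {m n} (h : Fin m → Fin n) → Injective _≡_ _≡_ h →
              (b : Fin n → Bool) → (∀ x → b x ≡ true ⇔ ∃ λ t → h t ≡ x) →
              (g : Fin n → Bool) → sum (λ x → b x ∧ g x) ≡ sum (g ∘ h)
  sum-image {m} h h-injective b b⇔image g = begin
    sum (λ x → b x ∧ g x)
      ≡⟨ sum-cong-≗ (λ x → cong (_∧ g x) (b≡count x)) ⟩
    sum (λ x → sum (λ t → ⌊ h t ≟ x ⌋) ∧ g x)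
      ≡⟨ sum-cong-≗ (λ x → *-distribʳ-sum (g x) (λ t → ⌊ h t ≟ x ⌋)) ⟩
    sum (λ x → sum (λ t → ⌊ h t ≟ x ⌋ ∧ g x))
      ≡⟨ ∑-comm (λ x t → ⌊ h t ≟ x ⌋ ∧ g x) ⟩
    sum (λ t → sum (λ x → ⌊ h t ≟ x ⌋ ∧ g x))
      ≡⟨ sum-cong-≗ (λ t → sum-indicator (h t) g) ⟩
    sum (g ∘ h)
      ∎
    where
    b≡count : ∀ x → b x ≡ sum (λ t → ⌊ h t ≟ x ⌋)
    b≡count x with b x in bx
    ... | true  = let (t₀ , ht₀≡x) = Equivalence.to (b⇔image x) bx in sym (begin
      sum (λ t → ⌊ h t ≟ x ⌋)
        ≡⟨ sum-cong-≗ (λ t → trans (hits ht₀≡x t) (sym (∧-identityʳ ⌊ t₀ ≟ t ⌋))) ⟩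
      sum (λ t → ⌊ t₀ ≟ t ⌋ ∧ true)
        ≡⟨ sum-indicator t₀ (λ _ → true) ⟩
      true
        ∎)
      where
      hits : ∀ {t₀} → h t₀ ≡ x → ∀ t → ⌊ h t ≟ x ⌋ ≡ ⌊ t₀ ≟ t ⌋
      hits {t₀} ht₀≡x t = ⌊⌋-⇔ (mk⇔ (λ ht≡x → h-injective (trans ht₀≡x (sym ht≡x))) λ { refl → ht₀≡x })
                               (h t ≟ x) (t₀ ≟ t)
    ... | false = sym (trans (sum-cong-≗ (λ t → ⌊⌋-false (h t ≟ x) (misses t))) (sum-replicate-zero m))
      where
      misses : ∀ t → h t ≢ x
      misses t ht≡x = false≢true (trans (sym bx) (Equivalence.from (b⇔image x) (t , ht≡x)))

  sum-determines-missing-term : ∀ {n} (b f g : Fin n → Bool) (s : Fin n) → b s ≡ true →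
                                (∀ x → b x ≡ true → x ≢ s → f x ≡ g x) →
                                sum (λ x → b x ∧ f x) ≡ sum (λ x → b x ∧ g x) → f s ≡ g s
  sum-determines-missing-term b f g s bs agree sums≡ = xor≡false⇒≡ (begin
    f s xor g s
      ≡⟨ sum-indicator s (λ _ → f s xor g s) ⟨
    sum (λ x → ⌊ s ≟ x ⌋ ∧ (f s xor g s))
      ≡⟨ sum-cong-≗ concentrated ⟨
    sum (λ x → b x ∧ (f x xor g x))
      ≡⟨ sum-cong-≗ (λ x → ∧-distribˡ-xor (b x) (f x) (g x)) ⟩
    sum (λ x → (b x ∧ f x) xor (b x ∧ g x))
      ≡⟨ ∑-distrib-+ (λ x → b x ∧ f x) (λ x → b x ∧ g x) ⟩
    sum (λ x → b x ∧ f x) xor sum (λ x → b x ∧ g x)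
      ≡⟨ cong (_xor sum (λ x → b x ∧ g x)) sums≡ ⟩
    sum (λ x → b x ∧ g x) xor sum (λ x → b x ∧ g x)
      ≡⟨ xor-same (sum (λ x → b x ∧ g x)) ⟩
    false
      ∎)
    where
    concentrated : ∀ x → b x ∧ (f x xor g x) ≡ ⌊ s ≟ x ⌋ ∧ (f s xor g s)
    concentrated x with s ≟ x
    ... | yes refl rewrite bs = refl
    ... | no s≢x with b x in bx
    ...   | true  = trans (cong (_xor g x) (agree x bx (s≢x ∘ sym))) (xor-same (g x))
    ...   | false = refl

  module Rotation (n : ℕ) where

    next : Fin (suc n) → Fin (suc n)
    next t = fromℕ< (m%n<n (suc (toℕ t)) (suc n))

    toℕ-next : ∀ t → toℕ (next t) ≡ suc (toℕ t) % suc n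
    toℕ-next t = toℕ-fromℕ< (m%n<n (suc (toℕ t)) (suc n))

    suc-%-cases : ∀ {a} → a < suc n →
                  (suc a < suc n × suc a % suc n ≡ suc a) ⊎ (a ≡ n × suc a % suc n ≡ 0)
    suc-%-cases a<1+n with m≤n⇒m<n∨m≡n a<1+n
    ... | inj₁ 1+a<1+n = inj₁ (1+a<1+n , m<n⇒m%n≡m 1+a<1+n)
    ... | inj₂ 1+a≡1+n = inj₂ (suc-injective 1+a≡1+n , trans (cong (_% suc n) 1+a≡1+n) (n%n≡0 (suc n)))

    next-cases : ∀ t → (toℕ (next t) ≡ suc (toℕ t)) ⊎ (toℕ t ≡ n × toℕ (next t) ≡ 0)
    next-cases t with suc-%-cases (toℕ<n t)
    ... | inj₁ (_ , wraps-not) = inj₁ (trans (toℕ-next t) wraps-not)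
    ... | inj₂ (t≡n , wraps)   = inj₂ (t≡n , trans (toℕ-next t) wraps)

    next-injective : Injective _≡_ _≡_ next
    next-injective {a} {b} na≡nb with next-cases a | next-cases b | cong toℕ na≡nb
    ... | inj₁ a↦ | inj₁ b↦ | eq = toℕ-injective (suc-injective (trans (sym a↦) (trans eq b↦)))
    ... | inj₁ a↦ | inj₂ (_ , b↦) | eq with trans (sym a↦) (trans eq b↦)
    ...   | ()
    next-injective _ | inj₂ (_ , a↦) | inj₁ b↦ | eq with trans (sym b↦) (trans (sym eq) a↦)
    ...   | ()
    next-injective _ | inj₂ (a≡n , _) | inj₂ (b≡n , _) | _ = toℕ-injective (trans a≡n (sym b≡n))

    next-surjective : StrictlySurjective _≡_ next
    next-surjective zero    = fromℕ n , toℕ-injective (begin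
      toℕ (next (fromℕ n))          ≡⟨ toℕ-next (fromℕ n) ⟩
      suc (toℕ (fromℕ n)) % suc n   ≡⟨ cong (λ m → suc m % suc n) (toℕ-fromℕ n) ⟩
      suc n % suc n                 ≡⟨ n%n≡0 (suc n) ⟩
      0                             ∎)
    next-surjective (suc j) = inject₁ j , toℕ-injective (begin
      toℕ (next (inject₁ j))          ≡⟨ toℕ-next (inject₁ j) ⟩
      suc (toℕ (inject₁ j)) % suc n   ≡⟨ cong (λ m → suc m % suc n) (toℕ-inject₁ j) ⟩
      suc (toℕ j) % suc n             ≡⟨ m<n⇒m%n≡m (s≤s (toℕ<n j)) ⟩
      suc (toℕ j)                     ∎)

    rotation : Permutation (suc n) (suc n)
    rotation = permutation next (proj₁ ∘ next-surjective) (proj₂ ∘ next-surjective)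
                           (λ t → next-injective (proj₂ (next-surjective (next t))))

    sum-rotate : ∀ g → sum (g ∘ next) ≡ sum g
    sum-rotate g = sym (∑-permute g rotation)

  next²≢id : ∀ k (t : Fin (3 + k)) → Rotation.next (2 + k) (Rotation.next (2 + k) t) ≢ t
  next²≢id k t next²t≡t with R.next-cases t | R.next-cases (R.next t) | cong toℕ next²t≡t
    where module R = Rotation (2 + k)
  ... | inj₁ t↦ | inj₁ t′↦ | eq = m≢2+m (trans (sym eq) (trans t′↦ (cong suc t↦)))
    where
    m≢2+m : ∀ {m} → m ≢ suc (suc m)
    m≢2+m ()
  ... | inj₁ t↦ | inj₂ (t′≡n , t″↦) | eq
    with trans (sym t′≡n) (trans t↦ (cong suc (trans (sym eq) t″↦)))
  ...   | ()
  next²≢id k t _ | inj₂ (t≡n , t′↦) | inj₁ t″↦ | eq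
    with trans (sym t≡n) (trans (sym eq) (trans t″↦ (cong suc t′↦)))
  ...   | ()
  next²≢id k t _ | inj₂ (_ , t′↦) | inj₂ (t′≡n , _) | _ with trans (sym t′≡n) t′↦
  ...   | ()

  transpose-matchʳ : ∀ {n} (i j : Fin n) → PC.transpose i j j ≡ i
  transpose-matchʳ i j with j ≟ i
  ... | yes j≡i = j≡i
  ... | no _    rewrite dec-true (j ≟ j) refl = refl

  transpose-fixes : ∀ {n} {i j k : Fin n} → k ≢ i → k ≢ j → PC.transpose i j k ≡ k
  transpose-fixes {i = i} {j} {k} k≢i k≢j rewrite dec-false (k ≟ i) k≢i | dec-false (k ≟ j) k≢j = refl

  module _ {n} {i j : Fin n} (i≤j : toℕ i ≤ toℕ j) where

    transpose-fixes-below : ∀ {k} → toℕ k < toℕ i → PC.transpose i j k ≡ k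
    transpose-fixes-below k<i = transpose-fixes (λ { refl → <-irrefl refl k<i }) (λ { refl → <⇒≱ k<i i≤j })

    transpose-reflects-below : ∀ k → toℕ (PC.transpose i j k) < toℕ i → toℕ k < toℕ i
    transpose-reflects-below k τk<i with k ≟ i | k ≟ j
    ... | yes refl | _        = ⊥-elim (<⇒≱ τk<i i≤j)
    ... | no _     | yes refl rewrite dec-true (k ≟ k) refl = ⊥-elim (<-irrefl refl τk<i)
    ... | no _     | no k≢j   rewrite dec-false (k ≟ j) k≢j = τk<i

  record Identification {L : ℕ} (a b : Fin L) : Set where
    field
      one-fewer        : suc (ℕ.pred L) ≡ L
      merge            : Fin L → Fin (ℕ.pred L)
      merge-identifies : merge a ≡ merge b
      merge-reflects   : ∀ {l l′} → merge l ≡ merge l′ → l ≡ l′ ⊎ SameEnds a b l l′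
      merge-surjective : StrictlySurjective _≡_ merge

  -- Redirect b to a, then close the gap left at b.
  identify : ∀ {L} (a b : Fin L) → a ≢ b → Identification a b
  identify {suc L} a b a≢b = record
    { one-fewer        = refl
    ; merge            = merge
    ; merge-identifies = punchOut-cong b (trans (redirect-fixes a≢b) (sym (redirect-b)))
    ; merge-reflects   = reflects
    ; merge-surjective = λ l → punchIn b l
                             , trans (punchOut-cong b (redirect-fixes (punchInᵢ≢i b l))) (punchOut-punchIn b)
    }
    where
    redirect : Fin (suc L) → Fin (suc L)
    redirect l with l ≟ b
    ... | yes _ = a
    ... | no _  = l

    redirect≢b : ∀ l → redirect l ≢ b
    redirect≢b l with l ≟ b
    ... | yes _ = a≢b
    ... | no l≢b = l≢b

    redirect-b : redirect b ≡ a
    redirect-b with b ≟ b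
    ... | yes _ = refl
    ... | no b≢b = ⊥-elim (b≢b refl)

    redirect-fixes : ∀ {l} → l ≢ b → redirect l ≡ l
    redirect-fixes {l} l≢b with l ≟ b
    ... | yes l≡b = ⊥-elim (l≢b l≡b)
    ... | no _    = refl

    merge : Fin (suc L) → Fin L
    merge l = punchOut (redirect≢b l ∘ sym)

    reflects : ∀ {l l′} → merge l ≡ merge l′ → l ≡ l′ ⊎ SameEnds a b l l′
    reflects {l} {l′} eq
      with punchOut-injective (redirect≢b l ∘ sym) (redirect≢b l′ ∘ sym) eq | l ≟ b | l′ ≟ b
    ... | _    | yes l≡b  | yes l′≡b = inj₁ (trans l≡b (sym l′≡b))
    ... | same | yes refl | no l′≢b  = inj₂ (inj₂ (trans (sym redirect-b) (trans same (redirect-fixes l′≢b)) , refl))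
    ... | same | no l≢b   | yes refl = inj₂ (inj₁ (trans (sym redirect-b) (trans (sym same) (redirect-fixes l≢b)) , refl))
    ... | same | no l≢b   | no l′≢b  = inj₁ (trans (sym (redirect-fixes l≢b)) (trans same (redirect-fixes l′≢b)))

  factors-through⇒≤ : ∀ {A : Set} {m n} (f : A → Fin m) (g : A → Fin n) → StrictlySurjective _≡_ f →
                      (∀ x y → g x ≡ g y → f x ≡ f y) → m ≤ n
  factors-through⇒≤ f g f-surjective g≡⇒f≡ = injective⇒≤ {f = g ∘ section} section-injective
    where
    section = proj₁ ∘ f-surjective
    section-injective : Injective _≡_ _≡_ (g ∘ section)
    section-injective {l} {l′} eq =
      trans (sym (proj₂ (f-surjective l))) (trans (g≡⇒f≡ _ _ eq) (proj₂ (f-surjective l′)))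

  ∈-tabulate : ∀ {n} {P : Fin n → Set} (P? : Decidable P) {v} → v ∈ tabulate (λ x → ⌊ P? x ⌋) ⇔ P v
  ∈-tabulate {P = P} P? {v} =
    mk⇔ to′ (λ p → lookup⇒[]= v _ (trans (lookup∘tabulate (λ x → ⌊ P? x ⌋) v) (⌊⌋-true (P? v) p)))
    where
    to′ : v ∈ tabulate (λ x → ⌊ P? x ⌋) → P v
    to′ v∈ with P? v | trans (sym (lookup∘tabulate (λ x → ⌊ P? x ⌋) v)) ([]=⇒lookup v∈)
    ... | yes p | _ = p
    ... | no _  | ()

  minimal-witness : ∀ {Q : ℕ → Set} → Decidable Q → ∀ {n} → Q n →
                    ∃ λ m → Q m × (∀ {j} → j < m → ¬ Q j)
  minimal-witness {Q} Q? {n} qn = descend (<-wellFounded n) qn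
    where
    descend : ∀ {n} → Acc _<_ n → Q n → ∃ λ m → Q m × (∀ {j} → j < m → ¬ Q j)
    descend {n} (acc below) qn with anyUpTo? Q? n
    ... | yes (j , j<n , qj) = descend (below j<n) qj
    ... | no none            = n , qn , λ {j} j<n qj → none (j , j<n , qj)

  module _ {n} {a b x y : Fin n} where

    SameEnds-swap : SameEnds a b x y → SameEnds a b y x
    SameEnds-swap (inj₁ (a≡x , b≡y)) = inj₂ (a≡x , b≡y)
    SameEnds-swap (inj₂ (a≡y , b≡x)) = inj₁ (a≡y , b≡x)

    SameEnds-sym : SameEnds a b x y → SameEnds x y a b
    SameEnds-sym (inj₁ (refl , refl)) = inj₁ (refl , refl)
    SameEnds-sym (inj₂ (refl , refl)) = inj₂ (refl , refl)

    SameEnds-trans : ∀ {x′ y′} → SameEnds a b x y → SameEnds x y x′ y′ → SameEnds a b x′ y′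
    SameEnds-trans (inj₁ (refl , refl)) s                    = s
    SameEnds-trans (inj₂ (refl , refl)) (inj₁ (refl , refl)) = inj₂ (refl , refl)
    SameEnds-trans (inj₂ (refl , refl)) (inj₂ (refl , refl)) = inj₁ (refl , refl)

    SameEnds-xor : SameEnds a b x y → (g : Fin n → Bool) → g a xor g b ≡ g x xor g y
    SameEnds-xor (inj₁ (refl , refl)) g = refl
    SameEnds-xor (inj₂ (refl , refl)) g = xor-comm (g y) (g x)

  Star-invariant : ∀ {A B : Set} {R : A → A → Set} (F : A → B) → (∀ {x y} → R x y → F x ≡ F y) →
                   ∀ {x y} → Star R x y → F x ≡ F y
  Star-invariant F F-invariant ε        = refl
  Star-invariant F F-invariant (r ◅ rs) = trans (F-invariant r) (Star-invariant F F-invariant rs)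

  a<b≤n⇒a+[n∸b]<n : ∀ {a b n} → a < b → b ≤ n → a + (n ∸ b) < n
  a<b≤n⇒a+[n∸b]<n {a} {b} {n} a<b b≤n =
    subst (a + (n ∸ b) <_) (m+[n∸m]≡n b≤n) (+-monoˡ-< (n ∸ b) a<b)

  a<b≤n⇒short-or-ends : ∀ {a b n} → a < b → b ≤ n → b ∸ a < n ⊎ (a ≡ 0 × b ≡ n)
  a<b≤n⇒short-or-ends {zero}  b≤n a<b with m≤n⇒m<n∨m≡n a<b
  ... | inj₁ b<n = inj₁ b<n
  ... | inj₂ b≡n = inj₂ (refl , b≡n)
  a<b≤n⇒short-or-ends {suc a} a<b b≤n = inj₁ (<-≤-trans (∸-monoʳ-< z<s (<⇒≤ a<b)) b≤n)

  cyclomatic-forest : ∀ {m n t c} → t + c ≡ n → t ≤ m → + m ℤ.- + n ℤ.+ + c ≡ + (m ∸ t)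
  cyclomatic-forest {m} {n} {t} {c} t+c≡n t≤m = begin
    + m ℤ.- + n ℤ.+ + c             ≡⟨ cong (λ v → + m ℤ.- v ℤ.+ + c) (cong +_ (sym t+c≡n)) ⟩
    + m ℤ.- + (t + c) ℤ.+ + c       ≡⟨ cong (λ v → + m ℤ.- v ℤ.+ + c) (pos-+ t c) ⟩
    + m ℤ.- (+ t ℤ.+ + c) ℤ.+ + c   ≡⟨ cancel (+ m) (+ t) (+ c) ⟩
    + m ℤ.- + t                     ≡⟨ m-n≡m⊖n m t ⟩
    m ℤ.⊖ t                         ≡⟨ ⊖-≥ t≤m ⟩
    + (m ∸ t)                       ∎
    where
    cancel : ∀ a b d → a ℤ.- (b ℤ.+ d) ℤ.+ d ≡ a ℤ.- b
    cancel = solve-∀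

  m-[m∸n]≡n : ∀ {m n} → n ≤ m → + m ℤ.- + (m ∸ n) ≡ + n
  m-[m∸n]≡n {m} {n} n≤m = begin
    + m ℤ.- + (m ∸ n)   ≡⟨ m-n≡m⊖n m (m ∸ n) ⟩
    m ℤ.⊖ (m ∸ n)       ≡⟨ ⊖-≥ (m∸n≤m m n) ⟩
    + (m ∸ (m ∸ n))     ≡⟨ cong +_ (m∸[m∸n]≡n n≤m) ⟩
    + n                 ∎

module Coboundary (G : Graph) where

  open import Algebra.Bundles using (CommutativeRing)
  open import Data.Bool using (Bool; true; false; _xor_; _∧_; _∨_)
  open import Data.Bool.Properties using (xor-∧-commutativeRing; xor-same; ∧-distribʳ-xor)
  open import Data.Nat using (ℕ; _+_)
  open import Data.Fin using (Fin; _≟_)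
  open import Data.Fin.Properties using (toℕ-injective)
  open import Data.Fin.Subset using (Subset; _∈_)
  open import Data.Vec using (lookup)
  open import Data.Vec.Properties using ([]=⇒lookup; lookup⇒[]=)
  open import Data.Product using (∃; _×_; _,_; proj₁; proj₂)
  open import Data.Sum using (_⊎_; inj₁; inj₂)
  open import Data.Empty using (⊥-elim)
  open import Function using (_∘_; _⇔_; mk⇔; Injective; Equivalence)
  open import Relation.Nullary using (yes; no)
  open import Relation.Nullary.Decidable using (⌊_⌋)
  open import Relation.Binary.PropositionalEquality hiding (_≗_)
  open ≡-Reasoning
  open Equivalence using (to; from)
  open Preliminaries

  open import Algebra.Properties.Semiring.Sum (CommutativeRing.semiring xor-∧-commutativeRing)
    using (sum; sum-cong-≗; ∑-distrib-+)

  open Graph G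

  same-ends⇒≡ : ∀ {e e′ x y} → SameEnds (src e) (tgt e) x y → SameEnds (src e′) (tgt e′) x y →
                e ≡ e′
  same-ends⇒≡ s s′ = simple _ _ (SameEnds-trans s (SameEnds-sym s′))

  δ : (Fin nV → Bool) → Fin nE → Bool
  δ y e = y (src e) xor y (tgt e)

  ρ-VE : ∀ y e → ρ (I-VE G) y e ≡ δ y e
  ρ-VE y e = begin
    ρ (I-VE G) y e
      ≡⟨ ∑≡sum (λ v → I-VE G v e ∧ y v) ⟩
    sum (λ v → I-VE G v e ∧ y v)
      ≡⟨ sum-cong-≗ (λ v → cong (_∧ y v) (endpoints v)) ⟩
    sum (λ v → (⌊ src e ≟ v ⌋ xor ⌊ tgt e ≟ v ⌋) ∧ y v)
      ≡⟨ sum-cong-≗ (λ v → ∧-distribʳ-xor (y v) ⌊ src e ≟ v ⌋ ⌊ tgt e ≟ v ⌋) ⟩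
    sum (λ v → (⌊ src e ≟ v ⌋ ∧ y v) xor (⌊ tgt e ≟ v ⌋ ∧ y v))
      ≡⟨ ∑-distrib-+ (λ v → ⌊ src e ≟ v ⌋ ∧ y v) (λ v → ⌊ tgt e ≟ v ⌋ ∧ y v) ⟩
    sum (λ v → ⌊ src e ≟ v ⌋ ∧ y v) xor sum (λ v → ⌊ tgt e ≟ v ⌋ ∧ y v)
      ≡⟨ cong₂ _xor_ (sum-indicator (src e) y) (sum-indicator (tgt e) y) ⟩
    δ y e
      ∎
    where
    endpoints : ∀ v → ⌊ src e ≟ v ⌋ ∨ ⌊ tgt e ≟ v ⌋ ≡ ⌊ src e ≟ v ⌋ xor ⌊ tgt e ≟ v ⌋
    endpoints v with src e ≟ v | tgt e ≟ v
    ... | yes refl | yes tgt≡src = ⊥-elim (loopless e (sym tgt≡src))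
    ... | yes _    | no _        = refl
    ... | no _     | yes _       = refl
    ... | no _     | no _        = refl

  ρ-CV : ∀ {c} (comp : Fin nV → Fin c) x v → ρ (I-CV G comp) x v ≡ x (comp v)
  ρ-CV comp x v = trans (∑≡sum (λ c → I-CV G comp c v ∧ x c)) (sum-indicator (comp v) x)

  edgesIn : Subset nV → Fin nE → Bool
  edgesIn S e = lookup S (src e) ∧ lookup S (tgt e)

  edgesIn⇔EdgeIn : ∀ S e → edgesIn S e ≡ true ⇔ _EdgeIn_ G e S
  edgesIn⇔EdgeIn S e = mk⇔ to′ from′
    where
    to′ : edgesIn S e ≡ true → _EdgeIn_ G e S
    to′ eq with lookup S (src e) in s∈ | lookup S (tgt e) in t∈
    ... | true | true = lookup⇒[]= (src e) S s∈ , lookup⇒[]= (tgt e) S t∈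
    from′ : _EdgeIn_ G e S → edgesIn S e ≡ true
    from′ (s∈ , t∈) rewrite []=⇒lookup s∈ | []=⇒lookup t∈ = refl

  module CycleEdges {S : Subset nV} {k : ℕ} {f : Fin (3 + k) → Fin nV} (f-injective : Injective _≡_ _≡_ f)
                    (mem : ∀ v → v ∈ S ⇔ ∃ λ i → f i ≡ v)
                    (adj : ∀ i j → Adj G (f i) (f j) ⇔ CycAdj G k i j) where
    open Rotation (2 + k)

    edge : Fin (3 + k) → Fin nE
    edge t = proj₁ (from (adj t (next t)) (inj₁ (sym (toℕ-next t))))

    edge-ends : ∀ t → SameEnds (src (edge t)) (tgt (edge t)) (f t) (f (next t))
    edge-ends t = proj₂ (from (adj t (next t)) (inj₁ (sym (toℕ-next t))))

    edge-injective : Injective _≡_ _≡_ edge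
    edge-injective {a} {b} eq with SameEnds-trans (SameEnds-sym (edge-ends a)) (subst Joins (sym eq) (edge-ends b))
      where
      Joins : Fin nE → Set
      Joins e = SameEnds (src e) (tgt e) (f b) (f (next b))
    ... | inj₁ (fa≡fb , _)       = f-injective fa≡fb
    ... | inj₂ (fa≡fnb , fna≡fb) =
      ⊥-elim (next²≢id k b (trans (cong next (sym (f-injective fa≡fnb))) (f-injective fna≡fb)))

    CycAdj⇒next : ∀ {i j} → CycAdj G k i j → next i ≡ j ⊎ next j ≡ i
    CycAdj⇒next {i} {j} (inj₁ i↦j) = inj₁ (toℕ-injective (trans (toℕ-next i) i↦j))
    CycAdj⇒next {i} {j} (inj₂ j↦i) = inj₂ (toℕ-injective (trans (toℕ-next j) j↦i))

    edgesIn⇔edge : ∀ e → edgesIn S e ≡ true ⇔ ∃ λ t → edge t ≡ e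
    edgesIn⇔edge e = mk⇔ to′ from′
      where
      to′ : edgesIn S e ≡ true → ∃ λ t → edge t ≡ e
      to′ eS with to (edgesIn⇔EdgeIn S e) eS
      ... | s∈ , t∈ with to (mem (src e)) s∈ | to (mem (tgt e)) t∈
      ... | i , fi≡s | j , fj≡t with CycAdj⇒next (to (adj i j) (e , inj₁ (sym fi≡s , sym fj≡t)))
      ... | inj₁ refl = i , same-ends⇒≡ (edge-ends i) (inj₁ (sym fi≡s , sym fj≡t))
      ... | inj₂ refl = j , same-ends⇒≡ (edge-ends j) (inj₂ (sym fi≡s , sym fj≡t))
      from′ : (∃ λ t → edge t ≡ e) → edgesIn S e ≡ true
      from′ (t , refl) = from (edgesIn⇔EdgeIn S e) (on-cycle (edge-ends t))
        where
        on-cycle : ∀ {a b} → SameEnds a b (f t) (f (next t)) → a ∈ S × b ∈ S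
        on-cycle (inj₁ (refl , refl)) = from (mem _) (t , refl) , from (mem _) (next t , refl)
        on-cycle (inj₂ (refl , refl)) = from (mem _) (next t , refl) , from (mem _) (t , refl)

  chordless-sum-δ : ∀ {S} → IsChordlessCycle G S → ∀ y → sum (λ e → edgesIn S e ∧ δ y e) ≡ false
  chordless-sum-δ {S} (k , f , f-injective , mem , adj) y = begin
    sum (λ e → edgesIn S e ∧ δ y e)              ≡⟨ sum-image edge edge-injective (edgesIn S) edgesIn⇔edge (δ y) ⟩
    sum (δ y ∘ edge)                             ≡⟨ sum-cong-≗ (λ t → SameEnds-xor (edge-ends t) y) ⟩
    sum (λ t → y (f t) xor y (f (next t)))       ≡⟨ ∑-distrib-+ (y ∘ f) (y ∘ f ∘ next) ⟩
    sum (y ∘ f) xor sum (y ∘ f ∘ next)           ≡⟨ cong (sum (y ∘ f) xor_) (sum-rotate (y ∘ f)) ⟩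
    sum (y ∘ f) xor sum (y ∘ f)                  ≡⟨ xor-same (sum (y ∘ f)) ⟩
    false                                        ∎
    where
    open CycleEdges f-injective mem adj
    open Rotation (2 + k)

module Walks (G : Graph) where

  open import Data.Nat using (ℕ; zero; suc; _+_; _∸_; _<_; _≤_; z<s; s<s)
  open import Data.Nat.Properties
    using (<-≤-trans; +-identityʳ; +-suc; +-monoʳ-<; m+[n∸m]≡n; n∸n≡0; +-∸-assoc; ∸-monoʳ-<)
  open import Data.Fin using (Fin; _≟_)
  open import Data.Fin.Properties using (any?)
  open import Data.Product using (∃; _×_; _,_)
  open import Relation.Nullary using (Dec)
  open import Relation.Nullary.Decidable using (map′; _×-dec_; _⊎-dec_)
  open import Relation.Unary using (Decidable)
  open import Relation.Binary.PropositionalEquality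
  open import Relation.Binary.Construct.Closure.ReflexiveTransitive using (Star; ε; _◅_)
  open Preliminaries using (SameEnds-swap)

  open Graph G

  AdjVia : (Fin nE → Set) → Fin nV → Fin nV → Set
  AdjVia P x y = ∃ λ e → P e × SameEnds (src e) (tgt e) x y

  ConnectedVia : (Fin nE → Set) → Fin nV → Fin nV → Set
  ConnectedVia P = Star (AdjVia P)

  record Walk (P : Fin nE → Set) (n : ℕ) (x y : Fin nV) : Set where
    field
      vertex : ℕ → Fin nV
      starts : vertex 0 ≡ x
      ends   : vertex n ≡ y
      step   : ∀ k → k < n → AdjVia P (vertex k) (vertex (suc k))

  open Walk

  module _ {P : Fin nE → Set} where

    AdjVia-sym : ∀ {x y} → AdjVia P x y → AdjVia P y x
    AdjVia-sym (e , Pe , s) = e , Pe , SameEnds-swap s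

    []ʷ : ∀ x → Walk P 0 x x
    []ʷ x = record { vertex = λ _ → x ; starts = refl ; ends = refl ; step = λ _ () }

    walk₀⇒≡ : ∀ {x y} → Walk P 0 x y → x ≡ y
    walk₀⇒≡ W = trans (sym (starts W)) (ends W)

    infixr 5 _∷ʷ_ _++ʷ_

    _∷ʷ_ : ∀ {n x z y} → AdjVia P x z → Walk P n z y → Walk P (suc n) x y
    _∷ʷ_ {x = x} a W = record { vertex = vertex′ ; starts = refl ; ends = ends W ; step = step′ }
      where
      vertex′ : ℕ → Fin nV
      vertex′ zero    = x
      vertex′ (suc k) = vertex W k
      step′ : ∀ k → k < suc _ → AdjVia P (vertex′ k) (vertex′ (suc k))
      step′ zero    _         = subst (AdjVia P x) (sym (starts W)) a
      step′ (suc k) (s<s k<n) = step W k k<n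

    uncons : ∀ {n x y} → Walk P (suc n) x y → ∃ λ z → AdjVia P x z × Walk P n z y
    uncons W = vertex W 1 , subst (λ v → AdjVia P v (vertex W 1)) (starts W) (step W 0 z<s) , record
      { vertex = λ k → vertex W (suc k)
      ; starts = refl
      ; ends   = ends W
      ; step   = λ k k<n → step W (suc k) (s<s k<n)
      }

    _++ʷ_ : ∀ {m n x y z} → Walk P m x y → Walk P n y z → Walk P (m + n) x z
    _++ʷ_ {zero}  {n} {z = z} W V = subst (λ v → Walk P n v z) (sym (walk₀⇒≡ W)) V
    _++ʷ_ {suc m}             W V with uncons W
    ... | _ , a , W′ = a ∷ʷ (W′ ++ʷ V)

    reverse : ∀ {n x y} → Walk P n x y → Walk P n y x
    reverse {n} W = record
      { vertex = λ k → vertex W (n ∸ k)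
      ; starts = ends W
      ; ends   = trans (cong (vertex W) (n∸n≡0 n)) (starts W)
      ; step   = λ k k<n → subst (λ j → AdjVia P (vertex W j) (vertex W (n ∸ suc k))) (sym (+-∸-assoc 1 k<n))
                             (AdjVia-sym (step W (n ∸ suc k) (∸-monoʳ-< z<s k<n)))
      }

    take : ∀ {n x y} (W : Walk P n x y) {a} → a ≤ n → Walk P a x (vertex W a)
    take W a≤n = record
      { vertex = vertex W
      ; starts = starts W
      ; ends   = refl
      ; step   = λ k k<a → step W k (<-≤-trans k<a a≤n)
      }

    drop : ∀ {n x y} (W : Walk P n x y) {b} → b ≤ n → Walk P (n ∸ b) (vertex W b) y
    drop W {b} b≤n = record
      { vertex = λ k → vertex W (b + k)
      ; starts = cong (vertex W) (+-identityʳ b)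
      ; ends   = trans (cong (vertex W) (m+[n∸m]≡n b≤n)) (ends W)
      ; step   = λ k k<n∸b → subst (λ j → AdjVia P (vertex W (b + k)) (vertex W j)) (sym (+-suc b k))
                               (step W (b + k) (subst (b + k <_) (m+[n∸m]≡n b≤n) (+-monoʳ-< b k<n∸b)))
      }

    segment : ∀ {n x y} (W : Walk P n x y) {a b} → a ≤ b → b ≤ n →
              Walk P (b ∸ a) (vertex W a) (vertex W b)
    segment W a≤b b≤n = drop (take W b≤n) a≤b

    connected⇒walk : ∀ {x y} → ConnectedVia P x y → ∃ λ n → Walk P n x y
    connected⇒walk {x} ε   = 0 , []ʷ x
    connected⇒walk (a ◅ c) with connected⇒walk c
    ... | n , W = suc n , a ∷ʷ W

    module _ (P? : Decidable P) where

      AdjVia? : ∀ x y → Dec (AdjVia P x y)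
      AdjVia? x y = any? λ e →
        P? e ×-dec (((src e ≟ x) ×-dec (tgt e ≟ y)) ⊎-dec ((src e ≟ y) ×-dec (tgt e ≟ x)))

      walk? : ∀ n x y → Dec (Walk P n x y)
      walk? zero    x y = map′ (λ { refl → []ʷ x }) walk₀⇒≡ (x ≟ y)
      walk? (suc n) x y = map′ (λ (_ , a , W) → a ∷ʷ W) uncons (any? λ z → AdjVia? x z ×-dec walk? n z y)

module ShortestCycles (G : Graph) where

  open import Data.Nat using (ℕ; zero; suc; _+_; _∸_; _%_; _<_; _≤_; z≤n; s≤s; s≤s⁻¹; _<?_)
  open import Data.Nat.Properties using (<-≤-trans; <⇒≤; ≤-antisym; ≮⇒≥; +-suc; <-cmp)
  open import Data.Nat.DivMod using (m<n⇒m%n≡m; n%n≡0)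
  open import Data.Fin using (Fin; toℕ; fromℕ; _≟_) renaming (zero to 0F)
  open import Data.Fin.Properties using (any?; toℕ-injective; toℕ<n; toℕ-fromℕ)
  open import Data.Fin.Subset using (Subset; _∈_)
  open import Data.Vec using (tabulate)
  open import Data.Product using (∃; _×_; _,_; proj₂)
  open import Data.Sum using (_⊎_; inj₁; inj₂; swap)
  open import Data.Empty using (⊥-elim)
  open import Function using (_⇔_; mk⇔; Equivalence; Injective)
  open import Relation.Nullary using (yes; no; ¬_)
  open import Relation.Nullary.Decidable using (⌊_⌋; _×-dec_; ¬?)
  open import Relation.Unary using (Decidable)
  open import Relation.Binary.Definitions using (tri<; tri≈; tri>)
  open import Relation.Binary.PropositionalEquality
  open Equivalence using (to; from)
  open Preliminaries

  open Graph G
  open Walks G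
  open Coboundary G
  open Walk

  closing-walk-length≥2 : ∀ {P e n} → ¬ P e → Walk P n (src e) (tgt e) → 2 ≤ n
  closing-walk-length≥2 {n = zero}        e∉P W = ⊥-elim (loopless _ (walk₀⇒≡ W))
  closing-walk-length≥2 {n = suc zero}    e∉P W with uncons W
  ... | _ , (e′ , Pe′ , ends′) , W′ with walk₀⇒≡ W′
  ... | refl = ⊥-elim (e∉P (subst _ (same-ends⇒≡ ends′ (inj₁ (refl , refl))) Pe′))
  closing-walk-length≥2 {n = suc (suc _)} e∉P W = s≤s (s≤s z≤n)

  record ClosesChordlessCycle (A : Fin nE → Set) (e : Fin nE) : Set where
    field
      cycle       : Subset nV
      chordless   : IsChordlessCycle G cycle
      e∈cycle     : _EdgeIn_ G e cycle
      others-in-A : ∀ e′ → _EdgeIn_ G e′ cycle → A e′ ⊎ e′ ≡ e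

  -- A shortest walk via A that closes up an edge outside A is an induced cycle: a chord in A, or a
  -- repeated vertex, would shorten the walk; a chord outside A would close up along a shorter walk.
  module ShortestClosure (A : Fin nE → Set) (A? : Decidable A) {e} (e∉A : ¬ A e)
                         {k} (W : Walk A (2 + k) (src e) (tgt e))
                         (shortest : ∀ {e′ m} → ¬ A e′ → m < 2 + k → ¬ Walk A m (src e′) (tgt e′)) where

    n : ℕ
    n = 2 + k

    no-shorter : ∀ {e′ m x y} → ¬ A e′ → m < n → SameEnds (src e′) (tgt e′) x y → ¬ Walk A m x y
    no-shorter e′∉A m<n (inj₁ (refl , refl)) V = shortest e′∉A m<n V
    no-shorter e′∉A m<n (inj₂ (refl , refl)) V = shortest e′∉A m<n (reverse V)

    vertices-distinct : ∀ {a b} → a < b → b ≤ n → vertex W a ≢ vertex W b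
    vertices-distinct {a} {b} a<b b≤n wa≡wb =
      shortest e∉A (a<b≤n⇒a+[n∸b]<n a<b b≤n)
        (take W (<⇒≤ (<-≤-trans a<b b≤n))
           ++ʷ subst (λ v → Walk A (n ∸ b) v (tgt e)) (sym wa≡wb) (drop W b≤n))

    no-chord-in-A : ∀ {a b} → suc a < b → b ≤ n → ¬ AdjVia A (vertex W a) (vertex W b)
    no-chord-in-A {a} {b} 1+a<b b≤n chord =
      shortest e∉A (subst (_< n) (sym (+-suc a (n ∸ b))) (a<b≤n⇒a+[n∸b]<n 1+a<b b≤n))
        (take W (<⇒≤ (<-≤-trans (<⇒≤ 1+a<b) b≤n)) ++ʷ chord ∷ʷ drop W b≤n)

    chord-outside-A : ∀ {e′ a b} → ¬ A e′ → a < b → b ≤ n →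
                      SameEnds (src e′) (tgt e′) (vertex W a) (vertex W b) → a ≡ 0 × b ≡ n
    chord-outside-A e′∉A a<b b≤n ends′ with a<b≤n⇒short-or-ends a<b b≤n
    ... | inj₁ short = ⊥-elim (no-shorter e′∉A short ends′ (segment W (<⇒≤ a<b) b≤n))
    ... | inj₂ ends  = ends

    cycleVertex : Fin (3 + k) → Fin nV
    cycleVertex t = vertex W (toℕ t)

    toℕ≤n : ∀ (t : Fin (3 + k)) → toℕ t ≤ n
    toℕ≤n t = s≤s⁻¹ (toℕ<n t)

    cycleVertex-injective : Injective _≡_ _≡_ cycleVertex
    cycleVertex-injective {i} {j} eq with <-cmp (toℕ i) (toℕ j)
    ... | tri< i<j _ _ = ⊥-elim (vertices-distinct i<j (toℕ≤n j) eq)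
    ... | tri≈ _ i≡j _ = toℕ-injective i≡j
    ... | tri> _ _ j<i = ⊥-elim (vertices-distinct j<i (toℕ≤n i) (sym eq))

    cycle : Subset nV
    cycle = tabulate (λ v → ⌊ any? (λ t → cycleVertex t ≟ v) ⌋)

    ∈cycle⇔ : ∀ v → v ∈ cycle ⇔ ∃ λ t → cycleVertex t ≡ v
    ∈cycle⇔ v = ∈-tabulate (λ v → any? (λ t → cycleVertex t ≟ v))

    consecutive⇒Adj : ∀ i j → suc (toℕ i) % (3 + k) ≡ toℕ j → Adj G (cycleVertex i) (cycleVertex j)
    consecutive⇒Adj i j i↦j with Rotation.suc-%-cases (2 + k) (toℕ<n i)
    ... | inj₁ (1+i<3+k , no-wrap) with step W (toℕ i) (s≤s⁻¹ 1+i<3+k)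
    ...   | e′ , _ , ends′ =
      e′ , subst (λ m → SameEnds (src e′) (tgt e′) (cycleVertex i) (vertex W m)) (trans (sym no-wrap) i↦j) ends′
    consecutive⇒Adj i j i↦j | inj₂ (i≡n , wrap) =
      e , inj₂ ( trans (sym (starts W)) (cong (vertex W) (trans (sym wrap) i↦j))
               , trans (sym (ends W)) (cong (vertex W) (sym i≡n)))

    CycAdj⇒Adj : ∀ i j → CycAdj G k i j → Adj G (cycleVertex i) (cycleVertex j)
    CycAdj⇒Adj i j (inj₁ i↦j) = consecutive⇒Adj i j i↦j
    CycAdj⇒Adj i j (inj₂ j↦i) with consecutive⇒Adj j i j↦i
    ... | e′ , ends′ = e′ , SameEnds-swap ends′

    ordered-Adj⇒CycAdj : ∀ i j → toℕ i < toℕ j → ∀ {e′} →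
                         SameEnds (src e′) (tgt e′) (cycleVertex i) (cycleVertex j) → CycAdj G k i j
    ordered-Adj⇒CycAdj i j i<j {e′} ends′ with A? e′
    ... | yes Ae′ with suc (toℕ i) <? toℕ j
    ...   | yes 1+i<j = ⊥-elim (no-chord-in-A 1+i<j (toℕ≤n j) (e′ , Ae′ , ends′))
    ...   | no 1+i≮j  = inj₁ (trans (m<n⇒m%n≡m (subst (_< 3 + k) j≡1+i (toℕ<n j))) (sym j≡1+i))
      where
      j≡1+i : toℕ j ≡ suc (toℕ i)
      j≡1+i = ≤-antisym (≮⇒≥ 1+i≮j) i<j
    ordered-Adj⇒CycAdj i j i<j {e′} ends′ | no e′∉A with chord-outside-A e′∉A i<j (toℕ≤n j) ends′
    ... | i≡0 , j≡n = inj₂ (trans (cong (λ m → suc m % (3 + k)) j≡n) (trans (n%n≡0 (3 + k)) (sym i≡0)))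

    Adj⇒CycAdj : ∀ i j → Adj G (cycleVertex i) (cycleVertex j) → CycAdj G k i j
    Adj⇒CycAdj i j (e′ , ends′) with <-cmp (toℕ i) (toℕ j)
    ... | tri< i<j _ _ = ordered-Adj⇒CycAdj i j i<j ends′
    ... | tri> _ _ j<i = swap (ordered-Adj⇒CycAdj j i j<i (SameEnds-swap ends′))
    ... | tri≈ _ i≡j _ with toℕ-injective i≡j | ends′
    ...   | refl | inj₁ (s≡ , t≡) = ⊥-elim (loopless e′ (trans s≡ (sym t≡)))
    ...   | refl | inj₂ (s≡ , t≡) = ⊥-elim (loopless e′ (trans s≡ (sym t≡)))

    chordless : IsChordlessCycle G cycle
    chordless = k , cycleVertex , cycleVertex-injective , ∈cycle⇔
              , λ i j → mk⇔ (Adj⇒CycAdj i j) (CycAdj⇒Adj i j)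

    e∈cycle : _EdgeIn_ G e cycle
    e∈cycle = from (∈cycle⇔ (src e)) (0F , starts W)
            , from (∈cycle⇔ (tgt e)) (fromℕ n , trans (cong (vertex W) (toℕ-fromℕ n)) (ends W))

    outside-A-on-cycle⇒≡e : ∀ {e′ a b} → ¬ A e′ → a < b → b ≤ n →
                            SameEnds (src e′) (tgt e′) (vertex W a) (vertex W b) → e′ ≡ e
    outside-A-on-cycle⇒≡e e′∉A a<b b≤n ends′ with chord-outside-A e′∉A a<b b≤n ends′
    ... | refl , refl = same-ends⇒≡ (subst₂ (SameEnds _ _) (starts W) (ends W) ends′) (inj₁ (refl , refl))

    others-in-A : ∀ e′ → _EdgeIn_ G e′ cycle → A e′ ⊎ e′ ≡ e
    others-in-A e′ (s∈ , t∈) with A? e′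
    ... | yes Ae′ = inj₁ Ae′
    ... | no e′∉A with to (∈cycle⇔ (src e′)) s∈ | to (∈cycle⇔ (tgt e′)) t∈
    ...   | i , fi≡s | j , fj≡t with <-cmp (toℕ i) (toℕ j)
    ...     | tri< i<j _ _ = inj₂ (outside-A-on-cycle⇒≡e e′∉A i<j (toℕ≤n j) (inj₁ (sym fi≡s , sym fj≡t)))
    ...     | tri> _ _ j<i = inj₂ (outside-A-on-cycle⇒≡e e′∉A j<i (toℕ≤n i) (inj₂ (sym fi≡s , sym fj≡t)))
    ...     | tri≈ _ i≡j _ =
      ⊥-elim (loopless e′ (trans (sym fi≡s) (trans (cong cycleVertex (toℕ-injective i≡j)) fj≡t)))

  closes-chordless-cycle : (A : Fin nE → Set) → Decidable A → (∀ e → ¬ A e → ConnectedVia A (src e) (tgt e)) →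
                           ∀ {e₀} → ¬ A e₀ → ∃ λ e → ¬ A e × ClosesChordlessCycle A e
  closes-chordless-cycle A A? connected {e₀} e₀∉A
    with minimal-witness Q? (e₀ , e₀∉A , proj₂ (connected⇒walk (connected e₀ e₀∉A)))
    where
    Q : ℕ → Set
    Q m = ∃ λ e → ¬ A e × Walk A m (src e) (tgt e)
    Q? : Decidable Q
    Q? m = any? λ e → ¬? (A? e) ×-dec walk? A? m (src e) (tgt e)
  ... | m , (e , e∉A , W) , shortest with closing-walk-length≥2 e∉A W
  ... | s≤s (s≤s _) =
    e , e∉A , record { ShortestClosure A A? e∉A W (λ e′∉A m<n V → shortest m<n (_ , e′∉A , V)) }

module EdgeOrders (G : Graph) where

  open import Algebra.Bundles using (CommutativeRing)
  open import Data.Bool using (Bool; true; false; _xor_; _∧_)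
  open import Data.Bool.Properties
    using (xor-∧-commutativeRing; ∧-distribˡ-xor; ∧-zeroʳ; ∧-identityʳ; xor-identityʳ; xor-assoc; xor-same)
  open import Data.Nat using (ℕ; zero; suc; _<_; _≤_; s≤s⁻¹)
  open import Data.Nat.Properties using (≤∧≢⇒<; ≤-antisym; m≤n⇒m<n∨m≡n; <⇒≤; ≤-refl)
  open import Data.Fin using (Fin; toℕ; fromℕ<)
  open import Data.Fin.Properties using (toℕ-injective; toℕ-fromℕ<; toℕ<n)
  open import Data.Fin.Permutation using (Permutation; _⟨$⟩ʳ_; _⟨$⟩ˡ_; inverseˡ; inverseʳ)
  open import Data.Product using (∃; _×_; _,_; proj₁)
  open import Data.Sum using (_⊎_; inj₁; inj₂)
  open import Function using (_∘_; Equivalence)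
  open import Relation.Nullary using (¬_)
  open import Relation.Binary.PropositionalEquality hiding (_≗_)
  open ≡-Reasoning
  open Equivalence using (to; from)
  open Preliminaries

  open import Algebra.Properties.CommutativeSemigroup (CommutativeRing.+-commutativeSemigroup xor-∧-commutativeRing)
    using (interchange)
  open import Algebra.Properties.Semiring.Sum (CommutativeRing.semiring xor-∧-commutativeRing)
    using (sum; sum-cong-≗; sum-replicate-zero)

  open Graph G
  open Coboundary G

  rank : Permutation nE nE → Fin nE → ℕ
  rank π e = toℕ (π ⟨$⟩ʳ e)

  rank-injective : ∀ π {e e′} → rank π e ≡ rank π e′ → e ≡ e′
  rank-injective π {e} {e′} eq = begin
    e                          ≡⟨ inverseˡ π ⟨
    π ⟨$⟩ˡ (π ⟨$⟩ʳ e)          ≡⟨ cong (π ⟨$⟩ˡ_) (toℕ-injective eq) ⟩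
    π ⟨$⟩ˡ (π ⟨$⟩ʳ e′)         ≡⟨ inverseˡ π ⟩
    e′                         ∎

  SeparatingCut : Permutation nE nE → Fin nE → Set
  SeparatingCut π e = ∃ λ y → δ y e ≡ true × (∀ e′ → rank π e′ < rank π e → δ y e′ ≡ false)

  max⇒others-before : ∀ {π e S} → (∀ e′ → _EdgeIn_ G e′ S → rank π e′ ≤ rank π e) →
                      ∀ e′ → edgesIn S e′ ≡ true → e′ ≢ e → rank π e′ < rank π e
  max⇒others-before {π} {S = S} max e′ e′∈S e′≢e =
    ≤∧≢⇒< (max e′ (to (edgesIn⇔EdgeIn S e′) e′∈S)) (e′≢e ∘ rank-injective π)

  cut⇒¬max : ∀ {π e} → SeparatingCut π e → ¬ IsMaxEdgeOfChordlessCycle G π e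
  cut⇒¬max {π} {e} (y , e-cut , before-uncut) (S , S-chordless , e∈S , max) =
    false≢true (trans (sym e-uncut) e-cut)
    where
    sums≡ : sum (λ e′ → edgesIn S e′ ∧ δ y e′) ≡ sum (λ e′ → edgesIn S e′ ∧ false)
    sums≡ = trans (chordless-sum-δ S-chordless y)
                  (sym (trans (sum-cong-≗ (λ e′ → ∧-zeroʳ (edgesIn S e′))) (sum-replicate-zero nE)))
    e-uncut : δ y e ≡ false
    e-uncut = sum-determines-missing-term (edgesIn S) (δ y) (λ _ → false) e (from (edgesIn⇔EdgeIn S e) e∈S)
                (λ e′ e′∈S e′≢e → before-uncut e′ (max⇒others-before {π} max e′ e′∈S e′≢e)) sums≡

  rank-≤⇒<⊎≡ : ∀ π {e e′} → rank π e′ ≤ rank π e → rank π e′ < rank π e ⊎ e′ ≡ e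
  rank-≤⇒<⊎≡ π e′≤e with m≤n⇒m<n∨m≡n e′≤e
  ... | inj₁ e′<e = inj₁ e′<e
  ... | inj₂ e′≡e = inj₂ (rank-injective π e′≡e)

  δ-xor : ∀ y w e → δ (λ x → y x xor w x) e ≡ δ y e xor δ w e
  δ-xor y w e = interchange (y (src e)) (w (src e)) (y (tgt e)) (w (tgt e))

  δ-∧ : ∀ c χ e → δ (λ x → c ∧ χ x) e ≡ c ∧ δ χ e
  δ-∧ c χ e = sym (∧-distribˡ-xor c (χ (src e)) (χ (tgt e)))

  CycleFree : (Fin nE → Bool) → Set
  CycleFree z = ∀ S → IsChordlessCycle G S → sum (λ e → edgesIn S e ∧ z e) ≡ false

  module _ (π : Permutation nE nE) {y : Fin nV → Bool} {z : Fin nE → Bool} {e : Fin nE}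
           (agree-before : ∀ e′ → rank π e′ < rank π e → δ y e′ ≡ z e′) where

    -- χ is uncut before e, so adding c ∧ χ corrects e alone.
    extend-across-cut : SeparatingCut π e → ∃ λ y′ → ∀ e′ → rank π e′ ≤ rank π e → δ y′ e′ ≡ z e′
    extend-across-cut (χ , e-cut , before-uncut) = y′ , agree
      where
      c : Bool
      c = δ y e xor z e
      y′ : Fin nV → Bool
      y′ x = y x xor (c ∧ χ x)
      δy′ : ∀ e′ → δ y′ e′ ≡ δ y e′ xor (c ∧ δ χ e′)
      δy′ e′ = trans (δ-xor y (λ x → c ∧ χ x) e′) (cong (δ y e′ xor_) (δ-∧ c χ e′))
      agree : ∀ e′ → rank π e′ ≤ rank π e → δ y′ e′ ≡ z e′
      agree e′ e′≤e with rank-≤⇒<⊎≡ π e′≤e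
      ... | inj₁ e′<e = begin
        δ y′ e′                        ≡⟨ δy′ e′ ⟩
        δ y e′ xor (c ∧ δ χ e′)        ≡⟨ cong (λ b → δ y e′ xor (c ∧ b)) (before-uncut e′ e′<e) ⟩
        δ y e′ xor (c ∧ false)         ≡⟨ cong (δ y e′ xor_) (∧-zeroʳ c) ⟩
        δ y e′ xor false               ≡⟨ xor-identityʳ (δ y e′) ⟩
        δ y e′                         ≡⟨ agree-before e′ e′<e ⟩
        z e′                           ∎
      ... | inj₂ refl = begin
        δ y′ e                         ≡⟨ δy′ e ⟩
        δ y e xor (c ∧ δ χ e)          ≡⟨ cong (λ b → δ y e xor (c ∧ b)) e-cut ⟩
        δ y e xor (c ∧ true)           ≡⟨ cong (δ y e xor_) (∧-identityʳ c) ⟩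
        δ y e xor (δ y e xor z e)      ≡⟨ xor-assoc (δ y e) (δ y e) (z e) ⟨
        (δ y e xor δ y e) xor z e      ≡⟨ cong (_xor z e) (xor-same (δ y e)) ⟩
        z e                            ∎

    -- Both δ y and z sum to zero around the cycle, and they agree on all of it but e.
    extend-around-cycle : CycleFree z → IsMaxEdgeOfChordlessCycle G π e →
                          ∀ e′ → rank π e′ ≤ rank π e → δ y e′ ≡ z e′
    extend-around-cycle cycle-free (S , S-chordless , e∈S , max) e′ e′≤e with rank-≤⇒<⊎≡ π e′≤e
    ... | inj₁ e′<e = agree-before e′ e′<e
    ... | inj₂ refl = sum-determines-missing-term (edgesIn S) (δ y) z e (from (edgesIn⇔EdgeIn S e) e∈S)
                        (λ e″ e″∈S e″≢e → agree-before e″ (max⇒others-before {π} max e″ e″∈S e″≢e))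
                        (trans (chordless-sum-δ S-chordless y) (sym (cycle-free S S-chordless)))

  cuts-and-cycles⇒coboundary : ∀ π → (∀ e → SeparatingCut π e ⊎ IsMaxEdgeOfChordlessCycle G π e) →
                                ∀ z → CycleFree z → ∃ λ y → ∀ e → δ y e ≡ z e
  cuts-and-cycles⇒coboundary π cut-or-cycle z cycle-free with agree-below nE ≤-refl
    where
    extend-at : ∀ {i} e → rank π e ≡ i → (∃ λ y → ∀ e′ → rank π e′ < i → δ y e′ ≡ z e′) →
                ∃ λ y → ∀ e′ → rank π e′ < suc i → δ y e′ ≡ z e′
    extend-at e refl (y , agree) with cut-or-cycle e
    ... | inj₁ cut = let (y′ , agree′) = extend-across-cut π {y = y} agree cut
                     in y′ , λ e′ → agree′ e′ ∘ s≤s⁻¹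
    ... | inj₂ max = y , λ e′ → extend-around-cycle π {y = y} agree cycle-free max e′ ∘ s≤s⁻¹

    agree-below : ∀ i → i ≤ nE → ∃ λ y → ∀ e → rank π e < i → δ y e ≡ z e
    agree-below zero    _    = (λ _ → false) , λ _ ()
    agree-below (suc i) i<nE = extend-at (π ⟨$⟩ˡ fromℕ< i<nE) (trans (cong toℕ (inverseʳ π)) (toℕ-fromℕ< i<nE))
                                         (agree-below i (<⇒≤ i<nE))
  ... | y , agree = y , λ e → agree e (toℕ<n (π ⟨$⟩ʳ e))

  max-edge-unique : ∀ {π e e′} (m : IsMaxEdgeOfChordlessCycle G π e) (m′ : IsMaxEdgeOfChordlessCycle G π e′) →
                    proj₁ m ≡ proj₁ m′ → e ≡ e′
  max-edge-unique {π} (S , _ , e∈S , max) (.S , _ , e′∈S , max′) refl =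
    rank-injective π (≤-antisym (max′ _ e∈S) (max _ e′∈S))

module Greedy (G : Graph) where

  open import Data.Bool using (Bool; true; false)
  open import Data.Bool.Properties using (xor-same)
  open import Data.Nat as ℕ using (ℕ; zero; suc; _+_; _<_; _≤_; z≤n; s≤s; s≤s⁻¹; _<?_; _≤?_)
  open import Data.Nat.Properties
    using ( ≤-refl; ≤-trans; <⇒≤; <-≤-trans; ≤-<-trans; <-irrefl; ≮⇒≥; <⇒≱; m≤n⇒m<n∨m≡n; m<n⇒m<1+n; n≤1+n
          ; +-suc; n<1+n)
  open import Data.Fin using (Fin; toℕ; fromℕ<; _≟_)
  open import Data.Fin.Properties using (any?; toℕ-fromℕ<)
  open import Data.Fin.Permutation using (Permutation; _⟨$⟩ʳ_; _⟨$⟩ˡ_; _∘ₚ_; transpose; inverseʳ)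
  import Data.Fin.Permutation as Perm
  open import Data.Product using (_,_)
  open import Data.Sum using (_⊎_; inj₁; inj₂)
  open import Data.Empty using (⊥-elim)
  open import Function using (_∘_; id; _⇔_; mk⇔; Equivalence; StrictlySurjective; case_of_)
  open import Relation.Nullary using (yes; no; ¬_)
  open import Relation.Nullary.Decidable using (⌊_⌋; _×-dec_; ¬?)
  open import Relation.Binary.PropositionalEquality hiding (_≗_)
  open import Relation.Binary.Construct.Closure.ReflexiveTransitive using (Star; ε; _◅_; _◅◅_)
  import Relation.Binary.Construct.Closure.ReflexiveTransitive as Star
  open Equivalence using (to; from)
  open Preliminaries

  open Graph G
  open Coboundary G
  open Walks G
  open ShortestCycles G
  open EdgeOrders G

  Below : Permutation nE nE → ℕ → Fin nE → Set
  Below π i e = rank π e < i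

  -- forest-first keeps the forest edges in front: a forest step can only happen while forestSize ≡ i.
  record Stage (i : ℕ) : Set where
    field
      order             : Permutation nE nE
      forestSize        : ℕ
      components        : ℕ
      forest+components : forestSize + components ≡ nV
      forest≤i          : forestSize ≤ i
      label             : Fin nV → Fin components
      label-surjective  : StrictlySurjective _≡_ label
      label-classifies  : ∀ x y → label x ≡ label y ⇔ ConnectedVia (Below order i) x y
      forest-first      : forestSize < i → ∀ e → i ≤ rank order e → label (src e) ≡ label (tgt e)
      cut-before        : ∀ e → rank order e < forestSize → SeparatingCut order e
      cycle-after       : ∀ e → forestSize ≤ rank order e → rank order e < i → IsMaxEdgeOfChordlessCycle G order e

  initial : Stage 0
  initial = record
    { order             = Perm.id
    ; forestSize        = 0
    ; components        = nV
    ; forest+components = refl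
    ; forest≤i          = z≤n
    ; label             = id
    ; label-surjective  = λ x → x , refl
    ; label-classifies  = λ x y → mk⇔ (λ { refl → ε }) (λ { ε → refl ; ((_ , () , _) ◅ _) })
    ; forest-first      = λ ()
    ; cut-before        = λ _ ()
    ; cycle-after       = λ _ _ ()
    }

  module Move (π : Permutation nE nE) {i} (i<nE : i < nE) {e} (i≤e : i ≤ rank π e) where

    ι : Fin nE
    ι = fromℕ< i<nE

    π′ : Permutation nE nE
    π′ = π ∘ₚ transpose ι (π ⟨$⟩ʳ e)

    ι≤πe : toℕ ι ≤ rank π e
    ι≤πe = subst (_≤ rank π e) (sym (toℕ-fromℕ< i<nE)) i≤e

    rank-moved : rank π′ e ≡ i
    rank-moved = trans (cong toℕ (transpose-matchʳ ι (π ⟨$⟩ʳ e))) (toℕ-fromℕ< i<nE)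

    rank-fixed : ∀ {e′} → rank π e′ < i → rank π′ e′ ≡ rank π e′
    rank-fixed {e′} e′<i =
      cong toℕ (transpose-fixes-below ι≤πe (subst (rank π e′ <_) (sym (toℕ-fromℕ< i<nE)) e′<i))

    below-reflected : ∀ {e′} → rank π′ e′ < i → rank π e′ < i
    below-reflected {e′} e′<i = subst (rank π e′ <_) (toℕ-fromℕ< i<nE)
      (transpose-reflects-below ι≤πe (π ⟨$⟩ʳ e′) (subst (rank π′ e′ <_) (sym (toℕ-fromℕ< i<nE)) e′<i))

    above-reflected : ∀ {e′} → suc i ≤ rank π′ e′ → i ≤ rank π e′
    above-reflected {e′} i<e′ with rank π e′ <? i
    ... | yes e′<i = ⊥-elim (<⇒≱ e′<i (≤-trans (n≤1+n i) (subst (suc i ≤_) (rank-fixed e′<i) i<e′)))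
    ... | no e′≮i  = ≮⇒≥ e′≮i

    below-suc : ∀ {e′} → rank π′ e′ < suc i → rank π e′ < i ⊎ e′ ≡ e
    below-suc {e′} e′≤i with m≤n⇒m<n∨m≡n (s≤s⁻¹ e′≤i)
    ... | inj₁ e′<i = inj₁ (below-reflected e′<i)
    ... | inj₂ e′≡i = inj₂ (rank-injective π′ (trans e′≡i (sym rank-moved)))

    below-suc⁻¹ : ∀ {e′} → rank π e′ < i → rank π′ e′ < suc i
    below-suc⁻¹ e′<i = subst (_< suc i) (sym (rank-fixed e′<i)) (m<n⇒m<1+n e′<i)

    e-below-suc : rank π′ e < suc i
    e-below-suc = subst (_< suc i) (sym rank-moved) (n<1+n i)

    connected-mono : ∀ {x y} → ConnectedVia (Below π i) x y → ConnectedVia (Below π′ (suc i)) x y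
    connected-mono = Star.map λ (e′ , e′<i , ends) → e′ , below-suc⁻¹ e′<i , ends

    invariant-extends : ∀ {B : Set} (F : Fin nV → B) → (∀ {x y} → AdjVia (Below π i) x y → F x ≡ F y) →
                        F (src e) ≡ F (tgt e) → ∀ {x y} → ConnectedVia (Below π′ (suc i)) x y → F x ≡ F y
    invariant-extends F F-invariant F-e = Star-invariant F step
      where
      step : ∀ {x y} → AdjVia (Below π′ (suc i)) x y → F x ≡ F y
      step (e′ , e′≤i , ends) with below-suc e′≤i
      ... | inj₁ e′<i = F-invariant (e′ , e′<i , ends)
      step (_ , _ , inj₁ (refl , refl)) | inj₂ refl = F-e
      step (_ , _ , inj₂ (refl , refl)) | inj₂ refl = sym F-e

    cut-transfer : ∀ {e′} → rank π e′ < i → SeparatingCut π e′ → SeparatingCut π′ e′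
    cut-transfer {e′} e′<i (y , e′-cut , before-uncut) = y , e′-cut , λ e″ e″<e′ →
      let e″<i = below-reflected (<-≤-trans e″<e′ (subst (_≤ i) (sym (rank-fixed e′<i)) (<⇒≤ e′<i)))
      in before-uncut e″ (subst₂ _<_ (rank-fixed e″<i) (rank-fixed e′<i) e″<e′)

    max-transfer : ∀ {e′} → rank π e′ < i → IsMaxEdgeOfChordlessCycle G π e′ → IsMaxEdgeOfChordlessCycle G π′ e′
    max-transfer {e′} e′<i (S , S-chordless , e′∈S , max) = S , S-chordless , e′∈S , λ e″ e″∈S →
      let e″≤e′ = max e″ e″∈S
      in subst₂ _≤_ (sym (rank-fixed (≤-<-trans e″≤e′ e′<i))) (sym (rank-fixed e′<i)) e″≤e′

  module _ {i} (i<nE : i < nE) (stage : Stage i) where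
    open Stage stage

    forest-step : ∀ {e} → i ≤ rank order e → label (src e) ≢ label (tgt e) → Stage (suc i)
    forest-step {e} i≤e split = record
      { order             = π′
      ; forestSize        = suc forestSize
      ; components        = ℕ.pred components
      ; forest+components = trans (sym (+-suc forestSize _)) (trans (cong (forestSize +_) one-fewer) forest+components)
      ; forest≤i          = s≤s forest≤i
      ; label             = merge ∘ label
      ; label-surjective  = λ l → let (l₀ , l₀↦l) = merge-surjective l ; (x , x↦l₀) = label-surjective l₀
                                  in x , trans (cong merge x↦l₀) l₀↦l
      ; label-classifies  = λ x y → mk⇔ (merged⇒connected x y) connected⇒merged
      ; forest-first      = λ t<1+i → ⊥-elim (<-irrefl (cong suc forest≡i) t<1+i)
      ; cut-before        = cut-before′
      ; cycle-after       = λ e′ t<e′ e′≤i → ⊥-elim (<-irrefl refl (<-≤-trans e′≤i (subst (_≤ rank π′ e′) 1+t≡1+i t<e′)))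
      }
      where
      open Move order i<nE i≤e
      open Identification (identify (label (src e)) (label (tgt e)) split)

      forest≡i : forestSize ≡ i
      forest≡i with m≤n⇒m<n∨m≡n forest≤i
      ... | inj₁ t<i = ⊥-elim (split (forest-first t<i e i≤e))
      ... | inj₂ t≡i = t≡i

      1+t≡1+i : suc forestSize ≡ suc i
      1+t≡1+i = cong suc forest≡i

      old-invariant : ∀ {x y} → AdjVia (Below order i) x y → label x ≡ label y
      old-invariant adj = from (label-classifies _ _) (adj ◅ ε)

      old-connected : ∀ {x y} → label x ≡ label y → ConnectedVia (Below π′ (suc i)) x y
      old-connected = connected-mono ∘ to (label-classifies _ _)

      e-adj : AdjVia (Below π′ (suc i)) (src e) (tgt e)
      e-adj = e , e-below-suc , inj₁ (refl , refl)

      connected⇒merged : ∀ {x y} → ConnectedVia (Below π′ (suc i)) x y → merge (label x) ≡ merge (label y)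
      connected⇒merged = invariant-extends (merge ∘ label) (cong merge ∘ old-invariant) merge-identifies

      merged⇒connected : ∀ x y → merge (label x) ≡ merge (label y) → ConnectedVia (Below π′ (suc i)) x y
      merged⇒connected x y merged with merge-reflects merged
      ... | inj₁ same                  = old-connected same
      ... | inj₂ (inj₁ (sx≡x , ty≡y)) = old-connected (sym sx≡x) ◅◅ e-adj ◅ old-connected ty≡y
      ... | inj₂ (inj₂ (sy≡y , tx≡x)) = old-connected (sym tx≡x) ◅◅ AdjVia-sym e-adj ◅ old-connected sy≡y

      e-cut : SeparatingCut π′ e
      e-cut = y , cuts-e , before-uncut
        where
        y : Fin nV → Bool
        y x = ⌊ label x ≟ label (tgt e) ⌋
        cuts-e : δ y e ≡ true
        cuts-e rewrite ⌊⌋-false (label (src e) ≟ label (tgt e)) split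
                     | ⌊⌋-true (label (tgt e) ≟ label (tgt e)) refl = refl
        before-uncut : ∀ e′ → rank π′ e′ < rank π′ e → δ y e′ ≡ false
        before-uncut e′ e′<e rewrite old-invariant (e′ , below-reflected (subst (rank π′ e′ <_) rank-moved e′<e)
                                                       , inj₁ (refl , refl))
          = xor-same (y (tgt e′))

      cut-before′ : ∀ e′ → rank π′ e′ < suc forestSize → SeparatingCut π′ e′
      cut-before′ e′ e′≤t with below-suc (subst (λ t → rank π′ e′ < suc t) forest≡i e′≤t)
      ... | inj₁ e′<i = cut-transfer e′<i (cut-before e′ (subst (rank order e′ <_) (sym forest≡i) e′<i))
      ... | inj₂ refl = e-cut

    cycle-step : (∀ e → i ≤ rank order e → label (src e) ≡ label (tgt e)) → Stage (suc i)
    cycle-step joined with closes-chordless-cycle (Below order i) (λ e → rank order e <? i)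
                             (λ e e≮i → to (label-classifies _ _) (joined e (≮⇒≥ e≮i))) e₀≮i
      where
      e₀≮i : ¬ Below order i (order ⟨$⟩ˡ fromℕ< i<nE)
      e₀≮i = <-irrefl (trans (cong toℕ (inverseʳ order)) (toℕ-fromℕ< i<nE))
    ... | e , e≮i , closure = record
      { order             = π′
      ; forestSize        = forestSize
      ; components        = components
      ; forest+components = forest+components
      ; forest≤i          = ≤-trans forest≤i (n≤1+n i)
      ; label             = label
      ; label-surjective  = label-surjective
      ; label-classifies  = λ x y → mk⇔ (connected-mono ∘ to (label-classifies x y)) connected⇒same-label
      ; forest-first      = λ _ e′ i<e′ → joined e′ (above-reflected i<e′)
      ; cut-before        = cut-before′
      ; cycle-after       = cycle-after′
      }
      where
      i≤e : i ≤ rank order e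
      i≤e = ≮⇒≥ e≮i
      open Move order i<nE i≤e
      open ClosesChordlessCycle closure

      connected⇒same-label : ∀ {x y} → ConnectedVia (Below π′ (suc i)) x y → label x ≡ label y
      connected⇒same-label = invariant-extends label (λ adj → from (label-classifies _ _) (adj ◅ ε)) (joined e i≤e)

      cut-before′ : ∀ e′ → rank π′ e′ < forestSize → SeparatingCut π′ e′
      cut-before′ e′ e′<t = cut-transfer e′<i (cut-before e′ (subst (_< forestSize) (rank-fixed e′<i) e′<t))
        where
        e′<i : rank order e′ < i
        e′<i = below-reflected (<-≤-trans e′<t forest≤i)

      e-max : IsMaxEdgeOfChordlessCycle G π′ e
      e-max = cycle , chordless , e∈cycle , λ e′ e′∈cycle → case others-in-A e′ e′∈cycle of λ where
        (inj₁ e′<i) → subst₂ _≤_ (sym (rank-fixed e′<i)) (sym rank-moved) (<⇒≤ e′<i)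
        (inj₂ refl) → ≤-refl

      cycle-after′ : ∀ e′ → forestSize ≤ rank π′ e′ → rank π′ e′ < suc i → IsMaxEdgeOfChordlessCycle G π′ e′
      cycle-after′ e′ t≤e′ e′≤i with below-suc e′≤i
      ... | inj₁ e′<i = max-transfer e′<i (cycle-after e′ (subst (forestSize ≤_) (rank-fixed e′<i) t≤e′) e′<i)
      ... | inj₂ refl = e-max

    step : Stage (suc i)
    step with any? (λ e → (i ≤? rank order e) ×-dec ¬? (label (src e) ≟ label (tgt e)))
    ... | yes (e , i≤e , split) = forest-step i≤e split
    ... | no none               = cycle-step joined
      where
      joined : ∀ e → i ≤ rank order e → label (src e) ≡ label (tgt e)
      joined e i≤e with label (src e) ≟ label (tgt e)
      ... | yes same = same
      ... | no split = ⊥-elim (none (e , i≤e , split))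

  stage : ∀ i → i ≤ nE → Stage i
  stage zero    _    = initial
  stage (suc i) i<nE = step i<nE (stage i (<⇒≤ i<nE))

module Exactness (G : Graph) where

  open import Algebra.Bundles using (CommutativeRing)
  open import Data.Bool using (false; _xor_; _∧_)
  open import Data.Bool.Properties using (xor-∧-commutativeRing; xor-same)
  open import Data.Fin using (Fin)
  open import Data.Fin.Subset using (Subset)
  open import Data.Fin.Permutation using ()
  open import Data.Product using (∃; _,_; proj₁; proj₂)
  open import Data.Sum using (_⊎_; inj₁)
  open import Function using (_∘_; _⇔_; mk⇔; Equivalence)
  open import Function.Consequences.Propositional using (surjective⇒strictlySurjective)
  open import Relation.Binary.PropositionalEquality hiding (_≗_)
  open import Relation.Binary.Construct.Closure.ReflexiveTransitive using (ε; _◅_)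
  open ≡-Reasoning
  open Equivalence using (to; from)
  open Preliminaries

  open import Algebra.Properties.Semiring.Sum (CommutativeRing.semiring xor-∧-commutativeRing)
    using (sum; sum-cong-≗)

  open Graph G
  open Coboundary G
  open EdgeOrders G

  module _ {c} {comp : Fin nV → Fin c} (labelling : IsComponentLabelling G comp) where

    comp-classifies : ∀ u v → comp u ≡ comp v ⇔ Connected G u v
    comp-classifies = proj₂ labelling

    representative : Fin c → Fin nV
    representative = proj₁ ∘ surjective⇒strictlySurjective (proj₁ labelling)

    comp-representative : ∀ l → comp (representative l) ≡ l
    comp-representative = proj₂ ∘ surjective⇒strictlySurjective (proj₁ labelling)

    exact-at-components : ExactAtStart (ρ (I-CV G comp))
    exact-at-components x = mk⇔
      (λ ρx≡0 l → trans (cong x (sym (comp-representative l))) (trans (sym (ρ-CV comp x _)) (ρx≡0 _)))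
      (λ x≡0 v → trans (ρ-CV comp x v) (x≡0 (comp v)))

    exact-at-vertices : ExactAt (ρ (I-CV G comp)) (ρ (I-VE G))
    exact-at-vertices y = mk⇔ constant⇒factors factors⇒constant
      where
      constant⇒factors : IsZero (ρ (I-VE G) y) → ∃ λ x → ρ (I-CV G comp) x ≗ y
      constant⇒factors δy≡0 = y ∘ representative , λ v →
        trans (ρ-CV comp _ v) (constant (to (comp-classifies _ _) (comp-representative (comp v))))
        where
        constant : ∀ {u v} → Connected G u v → y u ≡ y v
        constant = Star-invariant y λ (e , ends) →
          xor≡false⇒≡ (trans (sym (SameEnds-xor ends y)) (trans (sym (ρ-VE y e)) (δy≡0 e)))
      factors⇒constant : (∃ λ x → ρ (I-CV G comp) x ≗ y) → IsZero (ρ (I-VE G) y)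
      factors⇒constant (x , x∘comp≗y) e = begin
        ρ (I-VE G) y e                            ≡⟨ ρ-VE y e ⟩
        y (src e) xor y (tgt e)                   ≡⟨ cong₂ _xor_ (y≡ (src e)) (y≡ (tgt e)) ⟨
        x (comp (src e)) xor x (comp (tgt e))     ≡⟨ cong (λ l → x (comp (src e)) xor x l) same-component ⟨
        x (comp (src e)) xor x (comp (src e))     ≡⟨ xor-same (x (comp (src e))) ⟩
        false                                     ∎
        where
        same-component : comp (src e) ≡ comp (tgt e)
        same-component = from (comp-classifies _ _) ((e , inj₁ (refl , refl)) ◅ ε)
        y≡ : ∀ v → x (comp v) ≡ y v
        y≡ v = trans (sym (ρ-CV comp x v)) (x∘comp≗y v)

  exact-at-edges : ∀ {k} {cyc : Fin k → Subset nV} → IsCycleEnumeration G cyc →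
                   ∀ π → (∀ e → SeparatingCut π e ⊎ IsMaxEdgeOfChordlessCycle G π e) →
                   ExactAt (ρ (I-VE G)) (ρ (I-EC G cyc))
  exact-at-edges {cyc = cyc} (_ , enumerated-chordless , enumeration-complete) π cut-or-cycle z =
    mk⇔ cycle-free⇒coboundary coboundary⇒cycle-free
    where
    ρ-EC : ∀ j → ρ (I-EC G cyc) z j ≡ sum (λ e → edgesIn (cyc j) e ∧ z e)
    ρ-EC j = ∑≡sum (λ e → edgesIn (cyc j) e ∧ z e)

    cycle-free⇒coboundary : IsZero (ρ (I-EC G cyc) z) → ∃ λ y → ρ (I-VE G) y ≗ z
    cycle-free⇒coboundary ρz≡0 with cuts-and-cycles⇒coboundary π cut-or-cycle z cycle-free
      where
      cycle-free : CycleFree z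
      cycle-free S S-chordless with enumeration-complete S S-chordless
      ... | j , refl = trans (sym (ρ-EC j)) (ρz≡0 j)
    ... | y , δy≡z = y , λ e → trans (ρ-VE y e) (δy≡z e)

    coboundary⇒cycle-free : (∃ λ y → ρ (I-VE G) y ≗ z) → IsZero (ρ (I-EC G cyc) z)
    coboundary⇒cycle-free (y , ρy≗z) j = begin
      ρ (I-EC G cyc) z j                       ≡⟨ ρ-EC j ⟩
      sum (λ e → edgesIn (cyc j) e ∧ z e)      ≡⟨ sum-cong-≗ (λ e → cong (edgesIn (cyc j) e ∧_) (z≡δy e)) ⟩
      sum (λ e → edgesIn (cyc j) e ∧ δ y e)    ≡⟨ chordless-sum-δ (enumerated-chordless j) y ⟩
      false                                    ∎
      where
      z≡δy : ∀ e → z e ≡ δ y e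
      z≡δy e = trans (sym (ρy≗z e)) (ρ-VE y e)

module FinalOrder (G : Graph) where

  open import Data.Nat as ℕ using (ℕ; _+_; _∸_; _<_; _≤?_)
  open import Data.Nat.Properties using (≰⇒>; ≤-refl; ≤-antisym; +-cancelˡ-≡; m+[n∸m]≡n; +-monoʳ-<; m≤m+n)
  open import Data.Integer as ℤ using (+_; +≤+)
  open import Data.Integer.Properties using (drop‿+≤+)
  open import Data.Fin using (Fin; toℕ; fromℕ<)
  open import Data.Fin.Properties using (toℕ<n; toℕ-injective; toℕ-fromℕ<; injective⇒≤)
  open import Data.Fin.Subset using (Subset)
  open import Data.Fin.Permutation using (_⟨$⟩ˡ_; inverseʳ)
  open import Data.Product using (_,_; proj₁; proj₂)
  open import Data.Sum using (_⊎_; inj₁; inj₂)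
  open import Data.Empty using (⊥-elim)
  open import Function using (id; _⇔_; mk⇔; Equivalence; Injective)
  open import Function.Consequences.Propositional using (surjective⇒strictlySurjective)
  open import Relation.Nullary using (yes; no)
  open import Relation.Binary.PropositionalEquality hiding (_≗_)
  open import Relation.Binary.Construct.Closure.ReflexiveTransitive using (gmap)
  open ≡-Reasoning
  open Equivalence using (to; from)
  open Preliminaries

  open Graph G
  open Walks G
  open EdgeOrders G
  open Greedy G
  open Stage (stage nE ≤-refl) public

  connected-via-all : ∀ x y → ConnectedVia (Below order nE) x y ⇔ Connected G x y
  connected-via-all x y = mk⇔ (gmap id λ (e , _ , ends) → e , ends) (gmap id λ (e , ends) → e , toℕ<n _ , ends)

  cut-or-cycle : ∀ e → SeparatingCut order e ⊎ IsMaxEdgeOfChordlessCycle G order e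
  cut-or-cycle e with forestSize ≤? rank order e
  ... | yes t≤e = inj₂ (cycle-after e t≤e (toℕ<n _))
  ... | no t≰e  = inj₁ (cut-before e (≰⇒> t≰e))

  module _ {c} {comp : Fin nV → Fin c} (labelling : IsComponentLabelling G comp) where

    components≡c : components ≡ c
    components≡c = let (comp-surjective , comp-classifies) = labelling in ≤-antisym
        (factors-through⇒≤ label comp label-surjective λ x y same →
          from (label-classifies x y) (from (connected-via-all x y) (to (comp-classifies x y) same)))
        (factors-through⇒≤ comp label (surjective⇒strictlySurjective comp-surjective) λ x y same →
          from (comp-classifies x y) (to (connected-via-all x y) (to (label-classifies x y) same)))

    cyclomatic≡ : cyclomatic G c ≡ + (nE ∸ forestSize)
    cyclomatic≡ = cyclomatic-forest (trans (cong (forestSize ℕ.+_) (sym components≡c)) forest+components) forest≤i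

    max-edges-last : ∀ e → IsMaxEdgeOfChordlessCycle G order e ⇔ (+ nE ℤ.- cyclomatic G c ℤ.≤ + rank order e)
    max-edges-last e = mk⇔
      (λ max → subst (ℤ._≤ + rank order e) (sym leading) (+≤+ (after-forest max)))
      (λ t≤e → cycle-after e (drop‿+≤+ (subst (ℤ._≤ + rank order e) leading t≤e)) (toℕ<n _))
      where
      leading : + nE ℤ.- cyclomatic G c ≡ + forestSize
      leading = trans (cong (λ v → + nE ℤ.- v) cyclomatic≡) (m-[m∸n]≡n forest≤i)
      after-forest : IsMaxEdgeOfChordlessCycle G order e → forestSize ℕ.≤ rank order e
      after-forest max with forestSize ≤? rank order e
      ... | yes t≤e = t≤e
      ... | no t≰e  = ⊥-elim (cut⇒¬max {order} (cut-before e (≰⇒> t≰e)) max)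

    cyclomatic≤cycles : ∀ {k} {cyc : Fin k → Subset nV} → IsCycleEnumeration G cyc → cyclomatic G c ℤ.≤ + k
    cyclomatic≤cycles {k} {cyc} (_ , _ , enumeration-complete) =
      subst (ℤ._≤ + k) (sym cyclomatic≡) (+≤+ (injective⇒≤ cycle-index-injective))
      where
      position< : ∀ (q : Fin (nE ∸ forestSize)) → forestSize + toℕ q < nE
      position< q = subst (forestSize + toℕ q <_) (m+[n∸m]≡n forest≤i) (+-monoʳ-< forestSize (toℕ<n q))
      edge : Fin (nE ∸ forestSize) → Fin nE
      edge q = order ⟨$⟩ˡ fromℕ< (position< q)
      rank-edge : ∀ q → rank order (edge q) ≡ forestSize + toℕ q
      rank-edge q = trans (cong toℕ (inverseʳ order)) (toℕ-fromℕ< (position< q))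
      max : ∀ q → IsMaxEdgeOfChordlessCycle G order (edge q)
      max q = cycle-after (edge q) (subst (forestSize ℕ.≤_) (sym (rank-edge q)) (m≤m+n _ _)) (toℕ<n _)
      cycle-index : Fin (nE ∸ forestSize) → Fin k
      cycle-index q = proj₁ (enumeration-complete (proj₁ (max q)) (proj₁ (proj₂ (max q))))
      indexes : ∀ q → cyc (cycle-index q) ≡ proj₁ (max q)
      indexes q = proj₂ (enumeration-complete (proj₁ (max q)) (proj₁ (proj₂ (max q))))
      cycle-index-injective : Injective _≡_ _≡_ cycle-index
      cycle-index-injective {q} {q′} same = toℕ-injective (+-cancelˡ-≡ forestSize _ _ (begin
        forestSize + toℕ q         ≡⟨ rank-edge q ⟨
        rank order (edge q)        ≡⟨ cong (rank order) (max-edge-unique {order} (max q) (max q′) same-cycle) ⟩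
        rank order (edge q′)       ≡⟨ rank-edge q′ ⟩
        forestSize + toℕ q′        ∎))
        where
        same-cycle : proj₁ (max q) ≡ proj₁ (max q′)
        same-cycle = trans (sym (indexes q)) (trans (cong cyc same) (indexes q′))

open import Data.Nat using (ℕ)
open import Data.Integer using (+_; _-_; _≤_)
open import Data.Fin using (Fin; toℕ)
open import Data.Fin.Subset using (Subset)
open import Data.Fin.Permutation using (Permutation; _⟨$⟩ʳ_)
open import Data.Product using (∃; _×_; _,_)
open import Function using (_⇔_)

proposition5p3 : (G : Graph) → (c : ℕ) (comp : Fin (Graph.nV G) → Fin c) → IsComponentLabelling G comp
    → (k : ℕ) (cyc : Fin k → Subset (Graph.nV G)) → IsCycleEnumeration G cyc
    → (∃ λ (pos : Permutation (Graph.nE G) (Graph.nE G)) → ∀ e → IsMaxEdgeOfChordlessCycle G pos e ⇔ (+ Graph.nE G - cyclomatic G c ≤ + toℕ (pos ⟨$⟩ʳ e)))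
      × (cyclomatic G c ≤ + k)
      × ExactAtStart (ρ (I-CV G comp))
      × ExactAt (ρ (I-CV G comp)) (ρ (I-VE G))
      × ExactAt (ρ (I-VE G)) (ρ (I-EC G cyc))
proposition5p3 G c comp labelling k cyc enumeration =
    (order , max-edges-last labelling)
  , cyclomatic≤cycles labelling enumeration
  , exact-at-components labelling
  , exact-at-vertices labelling
  , exact-at-edges enumeration order cut-or-cycle
  where
  open Exactness G
  open FinalOrder G
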